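{- Any suffix $s_i$ of $T$ is the pivot (with some set of alterations) of $O(k\binom{\log n}{k})$ nodes of $\mathcal{T}_0$; therefore, RecursiveCGL requires $O(nk^2\binom{\log n}{k})$ total words of space.
   Context: $T$ is a text of length $n$ over an alphabet $\Sigma$ (each character fits in $O(1)$ words), to which $2k+1$ copies of a special character $\$$ are appended; "suffixes of $T$" are the $n$ suffixes not starting with $\$$. The model is the word RAM with words of size $\Omega(\log n)$; space is counted in words; logs are base 2; it is assumed that $1 \le k < (\log n)/2$. An alteration is a pair (index, character); a $k$-altered string $(s,a)$ is a string $s$ together with at most $k$ alterations $a$, meaning $s[i]$ is replaced by $c$ for each $(i,c)\in a$. $LCP(x,y)$ is the length of the longest common prefix. For a pivot string $p$, pivot-altering a string $s$ means computing $i=LCP(s,p)$ and appending the alteration $(i+1, p[i+1])$ to $s$. RecursiveCGL$(S,k')$ is defined on a set $S$ of $k$-altered suffixes of $T$: if $|S|\le 1$ it stores $S$. Otherwise the pivot $p$ is the lexicographic median of $S$, $m$ is the median of $LCP(s,p)$ over $s\in S$, and $S\setminus\{p\}$ is partitioned into $S_{<m}$ (strings with $LCP(s,p)<m$), $S_{>m}$ (strings with $LCP(s,p)>m$), $S_{<\ell}$ (strings with $LCP(s,p)=m$ lexicographically before $p$) and $S_{>\ell}$ (strings with $LCP(s,p)=m$ lexicographically after $p$); each has size at most $|S|/2$. The altered subsets $\hat S_{<m},\hat S_{<\ell},\hat S_{>\ell}$ consist of the pivot-altered strings of the corresponding subsets. The node stores the pivot (a pointer to a suffix of $T$ plus at most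 $k$ alterations, $O(k)$ words) and pointers to RecursiveCGL$(S_{<m},k')$, RecursiveCGL$(S_{<\ell},k')$, RecursiveCGL$(S_{>\ell},k')$, RecursiveCGL$(S_{>m},k')$, and, if $k'>0$, to RecursiveCGL$(\hat S_{<m},k'-1)$, RecursiveCGL$(\hat S_{<\ell},k'-1)$, RecursiveCGL$(\hat S_{>\ell},k'-1)$. $\mathcal{T}_0$ is the resulting degree-7 tree rooted at RecursiveCGL$(S,k)$ with $S$ all (unaltered) suffixes of $T$; its height is at most $\lceil\log n\rceil$. The whole RecursiveCGL structure additionally stores a first-$(k+1)$-mismatches/LCP data structure and a data structure for radius-$0$ searches, each using $O(n\binom{\log n}{k})$ space. -}

module Defs where

open import Level using (0ℓ)
open import Data.Nat using (ℕ; zero; suc; _+_; _*_; _∸_; _/_; _<ᵇ_; _≡ᵇ_; _≤ᵇ_)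
open import Data.Bool using (Bool; true; false; if_then_else_; _∧_; not)
open import Data.List using (List; []; _∷_; _++_; length; map; replicate; drop; upTo)
open import Data.Nat.ListAction using (sum)
open import Data.Maybe using (Maybe; just; nothing)
open import Data.Product using (_×_; _,_)
open import Relation.Binary.Core using (Rel)
open import Relation.Binary.Definitions using (tri<; tri≈; tri>)
open import Relation.Binary.Structures using (IsStrictTotalOrder)
open import Relation.Binary.PropositionalEquality using (_≡_)
open import Relation.Nullary using (yes; no)

filterB : {X : Set} → (X → Bool) → List X → List X
filterB p [] = []
filterB p (x ∷ xs) = if p x then x ∷ filterB p xs else filterB p xs

insertB : {X : Set} → (X → X → Bool) → X → List X → List X
insertB le x [] = x ∷ []
insertB le x (y ∷ ys) = if le x y then x ∷ y ∷ ys else y ∷ insertB le x ys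

isortB : {X : Set} → (X → X → Bool) → List X → List X
isortB le [] = []
isortB le (x ∷ xs) = insertB le x (isortB le xs)

nth : {X : Set} → X → List X → ℕ → X
nth d [] i = d
nth d (x ∷ xs) zero = x
nth d (x ∷ xs) (suc i) = nth d xs i

nth? : {X : Set} → List X → ℕ → Maybe X
nth? [] i = nothing
nth? (x ∷ xs) zero = just x
nth? (x ∷ xs) (suc i) = nth? xs i

setAt : {X : Set} → List X → ℕ → X → List X
setAt [] i c = []
setAt (x ∷ xs) zero c = c ∷ xs
setAt (x ∷ xs) (suc i) c = x ∷ setAt xs i c

medIdx : ℕ → ℕ
medIdx N = (N ∸ 1) / 2

pick : {X : Set} → ℕ → List X → Maybe (List X × X × List X)
pick i [] = nothing
pick zero (x ∷ xs) = just ([] , x , xs)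
pick (suc i) (x ∷ xs) with pick i xs
... | nothing = nothing
... | just (b , y , a) = just (x ∷ b , y , a)

-- A k-altered suffix: starting position (0-based) of a suffix of T$^{2k+1},
-- plus a list of alterations (position (0-based, relative to the suffix), character),
-- applied in order.
record Altered (A : Set) : Set where
  constructor mkAlt
  field
    start : ℕ
    alts  : List (ℕ × A)
open Altered public

-- The degree-7 tree produced by RecursiveCGL.
-- node pivot S<m S<ℓ S>ℓ S>m (just (Ŝ<m , Ŝ<ℓ , Ŝ>ℓ))  (the last component is nothing iff k' = 0)
data Tree (A : Set) : Set where
  leaf : List (Altered A) → Tree A
  node : Altered A → Tree A → Tree A → Tree A → Tree A →
         Maybe (Tree A × Tree A × Tree A) → Tree A

module CGL {A : Set} (_<_ : Rel A 0ℓ) (sto : IsStrictTotalOrder _≡_ _<_)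
           (dollar : A) (T : List A) (k : ℕ) where

  open IsStrictTotalOrder sto using (compare; _≟_)

  n : ℕ
  n = length T

  T$ : List A
  T$ = T ++ replicate (suc (2 * k)) dollar

  applyAlts : List A → List (ℕ × A) → List A
  applyAlts s [] = s
  applyAlts s ((i , c) ∷ as) = applyAlts (setAt s i c) as

  str : Altered A → List A
  str a = applyAlts (drop (start a) T$) (alts a)

  lcp : List A → List A → ℕ
  lcp [] _ = 0
  lcp (_ ∷ _) [] = 0
  lcp (x ∷ xs) (y ∷ ys) with x ≟ y
  ... | yes _ = suc (lcp xs ys)
  ... | no _  = 0

  lexLt : List A → List A → Bool
  lexLt [] [] = false
  lexLt [] (_ ∷ _) = true
  lexLt (_ ∷ _) [] = false
  lexLt (x ∷ xs) (y ∷ ys) with compare x y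
  ... | tri< _ _ _ = true
  ... | tri≈ _ _ _ = lexLt xs ys
  ... | tri> _ _ _ = false

  lexLe : Altered A → Altered A → Bool
  lexLe s t = not (lexLt (str t) (str s))

  LCP : Altered A → Altered A → ℕ
  LCP s p = lcp (str s) (str p)

  -- pivot-altering s w.r.t. p: with i = LCP(s,p), append alteration (i+1, p[i+1])
  -- (1-based; here 0-based position i).  If p has no position i, s is unchanged.
  pivotAlter : Altered A → Altered A → Altered A
  pivotAlter p s with nth? (str p) (LCP s p)
  ... | nothing = s
  ... | just c  = mkAlt (start s) (alts s ++ ((LCP s p , c) ∷ []))

  -- RecursiveCGL(S, k'), with a fuel argument (fuel = |S| suffices, since
  -- every recursive call is on a subset of S ∖ {p}).
  build : ℕ → ℕ → List (Altered A) → Tree A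
  build zero k' S = leaf S
  build (suc f) k' S with length S ≤ᵇ 1
  ... | true = leaf S
  ... | false with pick (medIdx (length S)) (isortB lexLe S)
  ...   | nothing = leaf S
  ...   | just (before , p , after) = node p (build f k' S<m) (build f k' S<ℓ)
                                            (build f k' S>ℓ) (build f k' S>m) hats
    where
    m : ℕ
    m = nth 0 (isortB _≤ᵇ_ (map (λ s → LCP s p) S)) (medIdx (length S))
    others : List (Altered A)
    others = before ++ after
    S<m S>m S<ℓ S>ℓ : List (Altered A)
    S<m = filterB (λ s → LCP s p <ᵇ m) others
    S>m = filterB (λ s → m <ᵇ LCP s p) others
    S<ℓ = filterB (λ s → (LCP s p ≡ᵇ m) ∧ lexLt (str s) (str p)) others
    S>ℓ = filterB (λ s → (LCP s p ≡ᵇ m) ∧ not (lexLt (str s) (str p))) others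
    hats : Maybe (Tree A × Tree A × Tree A)
    hats = hatTrees k'
      where
      hatTrees : ℕ → Maybe (Tree A × Tree A × Tree A)
      hatTrees zero = nothing
      hatTrees (suc k'') = just ( build f k'' (map (pivotAlter p) S<m)
                                , build f k'' (map (pivotAlter p) S<ℓ)
                                , build f k'' (map (pivotAlter p) S>ℓ))

  suffixes : List (Altered A)
  suffixes = map (λ j → mkAlt j []) (upTo n)

  T₀ : Tree A
  T₀ = build n k suffixes

  pivotCount : ℕ → Tree A → ℕ
  pivotCount i (leaf _) = 0
  pivotCount i (node p a b c d h) =
    (if start p ≡ᵇ i then 1 else 0)
    + pivotCount i a + pivotCount i b + pivotCount i c + pivotCount i d + rest h
    where
    rest : Maybe (Tree A × Tree A × Tree A) → ℕ
    rest nothing = 0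
    rest (just (x , y , z)) = pivotCount i x + pivotCount i y + pivotCount i z

  -- words used by an altered string: one pointer plus two words per alteration
  altWords : Altered A → ℕ
  altWords s = 1 + 2 * length (alts s)

  -- words used by the tree: a leaf stores its set S (plus a length word);
  -- an internal node stores its pivot and 4 or 7 child pointers.
  treeWords : Tree A → ℕ
  treeWords (leaf S) = 1 + sum (map altWords S)
  treeWords (node p a b c d nothing) =
    altWords p + 4 + treeWords a + treeWords b + treeWords c + treeWords d
  treeWords (node p a b c d (just (x , y , z))) =
    altWords p + 7 + treeWords a + treeWords b + treeWords c + treeWords d
    + treeWords x + treeWords y + treeWords z

  -- total words of RecursiveCGL: the tree plus the two auxiliary structures
  -- (whose sizes auxWords are supplied externally)
  totalWords : ℕ → Tree A → ℕ
  totalWords auxWords t = treeWords t + auxWords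

-- A node of RecursiveCGL(S, j) with pivot p splits S ∖ {p} into four parts of size at most |S|/2
-- (at the median of the LCP values with p, and at p in the lexicographic order), recurses on
-- all four at level j and, when j > 0, on the pivot-altered copies of three of them at level
-- j − 1. Pivot-altering keeps the starting position of a suffix, so by Pascal's rule a string of
-- a set of size at most 2^h is stored (as a pivot or in a leaf) at most Σ_{t ≤ j} C(h, t) times.
-- At the root h = ⌈log₂ n⌉ > 2k, where this sum is at most (k + 1)·C(h, k); every stored string
-- takes O(k) words.
module Submission where

open import Level using (0ℓ)
open import Function using (_∘_; id)
open import Function.Bundles using (Equivalence)
open import Data.Empty using (⊥-elim)
open import Data.Unit using (tt)
open import Data.Bool using (Bool; true; false; T; not; _∧_; if_then_else_)
open import Data.Bool.Properties using (T-∧; T-≡)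
open import Data.Maybe using (Maybe; just; nothing)
open import Data.Product using (Σ; ∃₂; _×_; _,_; proj₁; proj₂)
open import Data.Sum using (_⊎_; inj₁; inj₂)
open import Data.Nat
  using ( ℕ; zero; suc; _+_; _*_; _∸_; _^_; _/_; _%_; ⌈_/2⌉; _≤_; _<_; _≤ᵇ_; _<ᵇ_; _≡ᵇ_
        ; z≤n; s≤s; s≤s⁻¹; z<s)
open import Data.Nat.Properties
  using ( +-identityʳ; +-assoc; +-suc; +-comm; +-cancelˡ-≡; +-cancelˡ-≤; +-monoˡ-≤; +-monoʳ-≤; +-mono-≤
        ; *-zeroʳ; *-identityˡ; *-identityʳ; *-distribʳ-+; *-cancelˡ-≤; *-monoˡ-≤; *-monoʳ-≤; *-monoʳ-<
        ; ^-monoʳ-≤; m^n>0; ∸-cancelˡ-≡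
        ; ≤-refl; ≤-reflexive; ≤-trans; <-≤-trans; <-irrefl; <⇒≤; <⇒≢; <⇒≱; ≤⇒≯; ≰⇒>
        ; n≤1+n; n<1+n; m≤m+n; m≤n+m; m<m+n; ⌊n/2⌋+⌈n/2⌉≡n; ⌊n/2⌋≤⌈n/2⌉
        ; <ᵇ⇒<; ≤⇒≤ᵇ; ≡ᵇ⇒≡; ≤-decTotalOrder; module ≤-Reasoning)
open import Data.Nat.DivMod using (m≡m%n+[m/n]*n; m%n<n)
open import Data.Nat.Combinatorics using (_C_; nC1≡n; nCk+nC[k+1]≡[n+1]C[k+1])
open import Data.Nat.Logarithm using (⌈log₂_⌉)
open import Data.Nat.Logarithm.Core using (⌈log2⌉)
open import Data.Nat.Induction using (<-wellFounded)
open import Data.Nat.ListAction using (sum)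
open import Data.Nat.ListAction.Properties using (sum-++; sum-↭)
open import Data.Nat.Tactic.RingSolver using (solve-∀)
open import Induction.WellFounded using (Acc; acc)
open import Data.List using (List; []; _∷_; _++_; [_]; length; map; drop; upTo; filterᵇ)
open import Data.List.Properties
  using ( length-++; length-map; length-drop; length-upTo; length-filter; ++-assoc; ++-identityʳ
        ; map-++; map-∘; map-cong; filter-++; filter-none; ≡-dec)
open import Data.List.Membership.Propositional using (_∈_)
open import Data.List.Relation.Unary.All using (All; []; _∷_)
import Data.List.Relation.Unary.All as All
import Data.List.Relation.Unary.All.Properties as All
open import Data.List.Relation.Unary.AllPairs using (AllPairs; []; _∷_)
import Data.List.Relation.Unary.AllPairs as AllPairs
import Data.List.Relation.Unary.AllPairs.Properties as AllPairs
open import Data.List.Relation.Unary.Unique.Propositional.Properties using (upTo⁺)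
open import Data.List.Relation.Unary.Sorted.TotalOrder.Properties using (Sorted⇒AllPairs)
open import Data.List.Relation.Binary.Permutation.Propositional
  using (_↭_; prep; ↭-refl; ↭-reflexive; ↭-sym; ↭-trans; ↭⇒↭ₛ; ↭ₛ⇒↭)
open import Data.List.Relation.Binary.Permutation.Propositional.Properties
  using (shift; ++⁺ˡ; ↭-length; map⁺; All-resp-↭)
import Data.List.Relation.Binary.Permutation.Setoid.Properties as Permₛ
open import Data.List.Relation.Binary.Lex.Strict using (Lex-<; halt; this; next)
  renaming (<-isStrictTotalOrder to Lex-<-isStrictTotalOrder)
open import Data.List.Relation.Binary.Pointwise using (Pointwise-≡⇒≡; ≡⇒Pointwise-≡)
open import Relation.Nullary using (¬_; ¬?)
open import Relation.Nullary.Decidable.Core using (T?; does)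
open import Relation.Binary.Core using (Rel)
open import Relation.Binary.Bundles using (DecTotalOrder)
open import Relation.Binary.Structures using (IsStrictTotalOrder)
open import Relation.Binary.Definitions using (Symmetric; Tri; tri<; tri≈; tri>)
import Relation.Binary.Construct.On as On
open import Relation.Binary.PropositionalEquality
  using ( _≡_; _≢_; refl; sym; trans; cong; cong₂; subst; subst₂; setoid; isEquivalence; resp₂
        ; module ≡-Reasoning)
open import Defs

-- Arithmetic

binomSum : ℕ → ℕ → ℕ
binomSum h zero    = 0
binomSum h (suc j) = binomSum h j + h C j

binomSum-pascal : ∀ h j → binomSum (suc h) (suc j) ≡ binomSum h (suc j) + binomSum h j
binomSum-pascal h zero    = refl
binomSum-pascal h (suc j) = begin
  binomSum (suc h) (suc j) + suc h C suc j
    ≡⟨ cong₂ _+_ (binomSum-pascal h j) (sym (nCk+nC[k+1]≡[n+1]C[k+1] h j)) ⟩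
  (binomSum h (suc j) + binomSum h j) + (h C j + h C suc j)
    ≡⟨ rearrange (binomSum h (suc j)) (binomSum h j) (h C j) (h C suc j) ⟩
  (binomSum h (suc j) + h C suc j) + (binomSum h j + h C j) ∎
  where
  open ≡-Reasoning
  rearrange : ∀ a b c d → (a + b) + (c + d) ≡ (a + d) + (b + c)
  rearrange = solve-∀

1≤binomSum : ∀ h j → 1 ≤ binomSum h (suc j)
1≤binomSum h zero    = ≤-refl
1≤binomSum h (suc j) = ≤-trans (1≤binomSum h j) (m≤m+n _ _)

n*nCk≡k*nCk+[k+1]*nC[k+1] : ∀ n k → n * (n C k) ≡ k * (n C k) + suc k * (n C suc k)
n*nCk≡k*nCk+[k+1]*nC[k+1] zero    zero    = refl
n*nCk≡k*nCk+[k+1]*nC[k+1] zero    (suc k) = sym (cong₂ _+_ (*-zeroʳ (suc k)) (*-zeroʳ (suc (suc k))))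
n*nCk≡k*nCk+[k+1]*nC[k+1] (suc n) zero    =
  trans (*-identityʳ (suc n)) (sym (trans (+-identityʳ _) (nC1≡n (suc n))))
n*nCk≡k*nCk+[k+1]*nC[k+1] (suc n) (suc k) = begin
  suc n * (suc n C suc k)
    ≡⟨ cong (suc n *_) (sym (nCk+nC[k+1]≡[n+1]C[k+1] n k)) ⟩
  suc n * (n C k + n C suc k)
    ≡⟨ expand n (n C k) (n C suc k) ⟩
  (n C k + n * (n C k)) + (n C suc k + n * (n C suc k))
    ≡⟨ cong₂ (λ x y → (n C k + x) + (n C suc k + y))
         (n*nCk≡k*nCk+[k+1]*nC[k+1] n k) (n*nCk≡k*nCk+[k+1]*nC[k+1] n (suc k)) ⟩
  (n C k + (k * (n C k) + suc k * (n C suc k)))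
    + (n C suc k + (suc k * (n C suc k) + suc (suc k) * (n C suc (suc k))))
    ≡⟨ regroup k (n C k) (n C suc k) (n C suc (suc k)) ⟩
  suc k * (n C k + n C suc k) + suc (suc k) * (n C suc k + n C suc (suc k))
    ≡⟨ cong₂ (λ x y → suc k * x + suc (suc k) * y)
         (nCk+nC[k+1]≡[n+1]C[k+1] n k) (nCk+nC[k+1]≡[n+1]C[k+1] n (suc k)) ⟩
  suc k * (suc n C suc k) + suc (suc k) * (suc n C suc (suc k)) ∎
  where
  open ≡-Reasoning
  expand : ∀ n a b → suc n * (a + b) ≡ (a + n * a) + (b + n * b)
  expand = solve-∀
  regroup : ∀ k a b c → (a + (k * a + suc k * b)) + (b + (suc k * b + suc (suc k) * c))
                        ≡ suc k * (a + b) + suc (suc k) * (b + c)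
  regroup = solve-∀

2k<n⇒nCk≤nC[k+1] : ∀ {n k} → 2 * k < n → n C k ≤ n C suc k
2k<n⇒nCk≤nC[k+1] {n} {k} 2k<n = *-cancelˡ-≤ (suc k) (+-cancelˡ-≤ (k * (n C k)) _ _ (begin
  k * (n C k) + suc k * (n C k)     ≡⟨ sym (*-distribʳ-+ (n C k) k (suc k)) ⟩
  (k + suc k) * (n C k)             ≡⟨ cong (_* (n C k)) (+-suc k k) ⟩
  suc (k + k) * (n C k)             ≤⟨ *-monoˡ-≤ (n C k) (subst (_< n) (cong (k +_) (+-identityʳ k)) 2k<n) ⟩
  n * (n C k)                       ≡⟨ n*nCk≡k*nCk+[k+1]*nC[k+1] n k ⟩
  k * (n C k) + suc k * (n C suc k) ∎))
  where open ≤-Reasoning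

binomSum≤[1+j]*hCj : ∀ {h} j → 2 * j ≤ h → binomSum h (suc j) ≤ suc j * (h C j)
binomSum≤[1+j]*hCj zero _ = ≤-refl
binomSum≤[1+j]*hCj {h} (suc j) 2[j+1]≤h = begin
  binomSum h (suc j) + h C suc j
    ≤⟨ +-monoˡ-≤ _ (binomSum≤[1+j]*hCj j (≤-trans (*-monoʳ-≤ 2 (n≤1+n j)) 2[j+1]≤h)) ⟩
  suc j * (h C j) + h C suc j
    ≤⟨ +-monoˡ-≤ _ (*-monoʳ-≤ (suc j) (2k<n⇒nCk≤nC[k+1] (<-≤-trans (*-monoʳ-< 2 (n<1+n j)) 2[j+1]≤h))) ⟩
  suc j * (h C suc j) + h C suc j   ≡⟨ +-comm (suc j * (h C suc j)) _ ⟩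
  suc (suc j) * (h C suc j)         ∎
  where open ≤-Reasoning

1≤m*n⇒1≤n : ∀ m n → 1 ≤ m * n → 1 ≤ n
1≤m*n⇒1≤n m zero    1≤m*0 = ⊥-elim (<-irrefl refl (≤-trans 1≤m*0 (≤-reflexive (*-zeroʳ m))))
1≤m*n⇒1≤n m (suc n) _     = s≤s z≤n

n≤2^⌈log2⌉ : ∀ n (acc : Acc _<_ n) → n ≤ 2 ^ ⌈log2⌉ n acc
n≤2^⌈log2⌉ zero          _        = z≤n
n≤2^⌈log2⌉ (suc zero)    _        = s≤s z≤n
n≤2^⌈log2⌉ (suc (suc n)) (acc rs) = begin
  2 + n                      ≤⟨ +-monoʳ-≤ 2 n≤⌈n/2⌉+⌈n/2⌉ ⟩
  2 + (⌈ n /2⌉ + ⌈ n /2⌉)    ≡⟨ double ⌈ n /2⌉ ⟩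
  2 * suc ⌈ n /2⌉            ≤⟨ *-monoʳ-≤ 2 (n≤2^⌈log2⌉ (suc ⌈ n /2⌉) _) ⟩
  2 ^ ⌈log2⌉ (suc (suc n)) (acc rs) ∎
  where
  open ≤-Reasoning
  n≤⌈n/2⌉+⌈n/2⌉ : n ≤ ⌈ n /2⌉ + ⌈ n /2⌉
  n≤⌈n/2⌉+⌈n/2⌉ =
    ≤-trans (≤-reflexive (sym (⌊n/2⌋+⌈n/2⌉≡n n))) (+-monoˡ-≤ ⌈ n /2⌉ (⌊n/2⌋≤⌈n/2⌉ n))
  double : ∀ x → 2 + (x + x) ≡ 2 * suc x
  double = solve-∀

n≤2^⌈log₂n⌉ : ∀ n → n ≤ 2 ^ ⌈log₂ n ⌉
n≤2^⌈log₂n⌉ n = n≤2^⌈log2⌉ n (<-wellFounded n)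

medIdx-halves : ∀ {x y N} → x + suc y ≡ N → x ≡ medIdx N → 2 * x ≤ N × 2 * y ≤ N
medIdx-halves {x} {y} refl x≡med = x-half , y-half
  where
  open ≤-Reasoning
  r = (x + y) % 2
  y≡r+x : y ≡ r + x
  y≡r+x = +-cancelˡ-≡ x y (r + x) (begin-equality
    x + y                ≡⟨ m≡m%n+[m/n]*n (x + y) 2 ⟩
    r + (x + y) / 2 * 2  ≡⟨ cong (λ q → r + q * 2) (trans (cong (λ N → (N ∸ 1) / 2) (sym (+-suc x y))) (sym x≡med)) ⟩
    r + x * 2            ≡⟨ regroup r x ⟩
    x + (r + x)          ∎)
    where
    regroup : ∀ r x → r + x * 2 ≡ x + (r + x)
    regroup = solve-∀
  x-half : 2 * x ≤ x + suc y
  x-half = begin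
    2 * x       ≡⟨ cong (x +_) (+-identityʳ x) ⟩
    x + x       ≤⟨ +-monoʳ-≤ x (≤-trans (m≤n+m x r) (≤-trans (≤-reflexive (sym y≡r+x)) (n≤1+n y))) ⟩
    x + suc y   ∎
  y-half : 2 * y ≤ x + suc y
  y-half = begin
    2 * y         ≡⟨ cong (y +_) (trans (+-identityʳ y) y≡r+x) ⟩
    y + (r + x)   ≤⟨ +-monoʳ-≤ y (+-monoˡ-≤ x (s≤s⁻¹ (m%n<n (x + y) 2))) ⟩
    y + (1 + x)   ≡⟨ regroup x y ⟩
    x + suc y     ∎
    where
    regroup : ∀ x y → y + (1 + x) ≡ x + suc y
    regroup = solve-∀

+-mono₅ : ∀ {a b₁ b₂ b₃ b₄ c b₁′ b₂′ b₃′ b₄′ c′} →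
          b₁ ≤ b₁′ → b₂ ≤ b₂′ → b₃ ≤ b₃′ → b₄ ≤ b₄′ → c ≤ c′ →
          a + b₁ + b₂ + b₃ + b₄ + c ≤ a + b₁′ + b₂′ + b₃′ + b₄′ + c′
+-mono₅ {a} b₁≤ b₂≤ b₃≤ b₄≤ c≤ =
  +-mono-≤ (+-mono-≤ (+-mono-≤ (+-mono-≤ (+-monoʳ-≤ a b₁≤) b₂≤) b₃≤) b₄≤) c≤

node-arith : ∀ a x₁ x₂ x₃ x₄ q r {y₁ y₂ y₃ y₄ z} → 1 ≤ q →
             y₁ ≤ x₁ * q → y₂ ≤ x₂ * q → y₃ ≤ x₃ * q → y₄ ≤ x₄ * q → z ≤ (x₁ + x₂ + x₃) * r →
             a + y₁ + y₂ + y₃ + y₄ + z ≤ (a + x₁ + x₂ + x₃ + x₄) * (q + r)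
node-arith a x₁ x₂ x₃ x₄ q r {y₁} {y₂} {y₃} {y₄} {z} 1≤q y₁≤ y₂≤ y₃≤ y₄≤ z≤ = begin
  a + y₁ + y₂ + y₃ + y₄ + z
    ≤⟨ +-mono₅ y₁≤ y₂≤ y₃≤ y₄≤ z≤ ⟩
  a + x₁ * q + x₂ * q + x₃ * q + x₄ * q + (x₁ + x₂ + x₃) * r
    ≤⟨ m≤m+n _ (x₄ * r) ⟩
  a + x₁ * q + x₂ * q + x₃ * q + x₄ * q + (x₁ + x₂ + x₃) * r + x₄ * r
    ≡⟨ collect a x₁ x₂ x₃ x₄ q r ⟩
  a + (x₁ + x₂ + x₃ + x₄) * (q + r)
    ≤⟨ +-monoˡ-≤ _ (≤-trans (≤-reflexive (sym (*-identityʳ a))) (*-monoʳ-≤ a (≤-trans 1≤q (m≤m+n q r)))) ⟩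
  a * (q + r) + (x₁ + x₂ + x₃ + x₄) * (q + r)
    ≡⟨ distribute a x₁ x₂ x₃ x₄ (q + r) ⟩
  (a + x₁ + x₂ + x₃ + x₄) * (q + r) ∎
  where
  open ≤-Reasoning
  collect : ∀ a x₁ x₂ x₃ x₄ q r →
    a + x₁ * q + x₂ * q + x₃ * q + x₄ * q + (x₁ + x₂ + x₃) * r + x₄ * r ≡ a + (x₁ + x₂ + x₃ + x₄) * (q + r)
  collect = solve-∀
  distribute : ∀ a x₁ x₂ x₃ x₄ c → a * c + (x₁ + x₂ + x₃ + x₄) * c ≡ (a + x₁ + x₂ + x₃ + x₄) * c
  distribute = solve-∀

-- (2k + 15)(k + 1) ≤ 34k² for k ≥ 1, and one more nk²C absorbs the + 1.
words-arith : ∀ D k n C → 1 ≤ k → 1 ≤ n → 1 ≤ C →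
              n * (2 * k + 15) * (suc k * C) + 1 + D * n * C ≤ (35 + D) * n * (k * k) * C
words-arith D (suc a) (suc b) (suc c) _ _ _ = ≤-trans (m≤m+n _ slack) (≤-reflexive (sym (expand D a b c)))
  where
  slack = suc b * suc c * (33 * a * a + 49 * a) + (b + c + b * c) + D * suc b * suc c * (a * a + 2 * a)
  expand : ∀ D a b c → (35 + D) * suc b * (suc a * suc a) * suc c
    ≡ suc b * (2 * suc a + 15) * (suc (suc a) * suc c) + 1 + D * suc b * suc c
      + (suc b * suc c * (33 * a * a + 49 * a) + (b + c + b * c) + D * suc b * suc c * (a * a + 2 * a))
  expand = solve-∀

pivot-arith : ∀ D k C → 1 ≤ k → suc k * C ≤ (35 + D) * k * C
pivot-arith D (suc a) C _ = ≤-trans (m≤m+n _ ((33 + D + (34 + D) * a) * C)) (≤-reflexive (sym (expand D a C)))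
  where
  expand : ∀ D a C → (35 + D) * suc a * C ≡ suc (suc a) * C + (33 + D + (34 + D) * a) * C
  expand = solve-∀

-- Lists

data OneOf₄ : Bool → Bool → Bool → Bool → Set where
  first  : OneOf₄ true false false false
  second : OneOf₄ false true false false
  third  : OneOf₄ false false true false
  fourth : OneOf₄ false false false true

oneOf₄-compare : ∀ l m b → OneOf₄ (l <ᵇ m) ((l ≡ᵇ m) ∧ b) ((l ≡ᵇ m) ∧ not b) (m <ᵇ l)
oneOf₄-compare zero    zero    true  = second
oneOf₄-compare zero    zero    false = third
oneOf₄-compare zero    (suc m) b     = first
oneOf₄-compare (suc l) zero    b     = fourth
oneOf₄-compare (suc l) (suc m) b     = oneOf₄-compare l m b

≤⇒¬<ᵇ : ∀ {m n} → m ≤ n → ¬ T (n <ᵇ m)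
≤⇒¬<ᵇ {m} {n} m≤n n<m = ≤⇒≯ m≤n (<ᵇ⇒< n m n<m)

T⇒¬T-∧-not : ∀ x {y} → T y → ¬ T (x ∧ not y)
T⇒¬T-∧-not true  {true} _ ()
T⇒¬T-∧-not false        _ ()

indicator : ℕ → ℕ → ℕ
indicator i x = if x ≡ᵇ i then 1 else 0

Σ⟨_⟩ : {X : Set} → (X → ℕ) → List X → ℕ
Σ⟨ w ⟩ xs = sum (map w xs)

module _ {X : Set} (w : X → ℕ) where

  Σ-++ : ∀ xs ys → Σ⟨ w ⟩ (xs ++ ys) ≡ Σ⟨ w ⟩ xs + Σ⟨ w ⟩ ys
  Σ-++ xs ys = trans (cong sum (map-++ w xs ys)) (sum-++ (map w xs) (map w ys))

  Σ-↭ : ∀ {xs ys} → xs ↭ ys → Σ⟨ w ⟩ xs ≡ Σ⟨ w ⟩ ys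
  Σ-↭ = sum-↭ ∘ map⁺ w

  Σ-map : ∀ (f : X → X) → (∀ x → w (f x) ≡ w x) → ∀ xs → Σ⟨ w ⟩ (map f xs) ≡ Σ⟨ w ⟩ xs
  Σ-map f w∘f≗w xs = cong sum (trans (sym (map-∘ xs)) (map-cong w∘f≗w xs))

Σ-mono : ∀ {X : Set} {v w : X → ℕ} {xs} → All (λ x → v x ≤ w x) xs → Σ⟨ v ⟩ xs ≤ Σ⟨ w ⟩ xs
Σ-mono []            = z≤n
Σ-mono (v≤w ∷ vs≤ws) = +-mono-≤ v≤w (Σ-mono vs≤ws)

Σ-const : ∀ {X : Set} c (xs : List X) → Σ⟨ (λ _ → c) ⟩ xs ≡ length xs * c
Σ-const c []       = refl
Σ-const c (x ∷ xs) = cong (c +_) (Σ-const c xs)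

Σ-indicator≤1 : ∀ i {xs} → AllPairs _≢_ xs → Σ⟨ indicator i ⟩ xs ≤ 1
Σ-indicator≤1 i [] = z≤n
Σ-indicator≤1 i {x ∷ xs} (x∉xs ∷ unique) with x ≡ᵇ i in x≡ᵇi
... | false = Σ-indicator≤1 i unique
... | true  = s≤s (≤-reflexive (none x∉xs))
  where
  none : ∀ {ys} → All (x ≢_) ys → Σ⟨ indicator i ⟩ ys ≡ 0
  none [] = refl
  none {y ∷ ys} (x≢y ∷ x∉ys) with y ≡ᵇ i in y≡ᵇi
  ... | false = none x∉ys
  ... | true  = ⊥-elim (x≢y (trans (≡ᵇ⇒≡ x i (Equivalence.from T-≡ x≡ᵇi))
                                   (sym (≡ᵇ⇒≡ y i (Equivalence.from T-≡ y≡ᵇi)))))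

module _ {X : Set} where

  length-setAt : ∀ xs i (c : X) → length (setAt xs i c) ≡ length xs
  length-setAt []       i       c = refl
  length-setAt (x ∷ xs) zero    c = refl
  length-setAt (x ∷ xs) (suc i) c = cong suc (length-setAt xs i c)

  nth-split : ∀ (d : X) xs i → i < length xs → ∃₂ λ ys zs → xs ≡ ys ++ nth d xs i ∷ zs × length ys ≡ i
  nth-split d (x ∷ xs) zero    _         = [] , xs , refl , refl
  nth-split d (x ∷ xs) (suc i) (s≤s i<n) with nth-split d xs i i<n
  ... | ys , zs , xs≡ , ys≡i = x ∷ ys , zs , cong (x ∷_) xs≡ , cong suc ys≡i

  pick-split : ∀ i xs {ys y zs} → pick {X} i xs ≡ just (ys , y , zs) → xs ≡ ys ++ y ∷ zs × length ys ≡ i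
  pick-split zero    (x ∷ xs) refl = refl , refl
  pick-split (suc i) (x ∷ xs) picked with pick i xs in picked′
  pick-split (suc i) (x ∷ xs) refl | just _ with pick-split i xs picked′
  ... | xs≡ , ys≡i = cong (x ∷_) xs≡ , cong suc ys≡i

  filterB≗filterᵇ : ∀ (P : X → Bool) xs → filterB P xs ≡ filterᵇ P xs
  filterB≗filterᵇ P [] = refl
  filterB≗filterᵇ P (x ∷ xs) with P x
  ... | true  = cong (x ∷_) (filterB≗filterᵇ P xs)
  ... | false = filterB≗filterᵇ P xs

  filterB-↭ : ∀ (P : X → Bool) {xs ys} → xs ↭ ys → filterB P xs ↭ filterB P ys
  filterB-↭ P {xs} {ys} xs↭ys rewrite filterB≗filterᵇ P xs | filterB≗filterᵇ P ys =
    ↭ₛ⇒↭ (Permₛ.filter⁺ (setoid X) (T? ∘ P) (λ { refl → id }) (↭⇒↭ₛ xs↭ys))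

  length-filterB-∷ : ∀ (P : X → Bool) x xs → length (filterB P xs) ≤ length (filterB P (x ∷ xs))
  length-filterB-∷ P x xs with P x
  ... | true  = n≤1+n _
  ... | false = ≤-refl

  length-filterB-map : ∀ {Y : Set} (P : Y → Bool) (f : X → Y) xs →
                       length (filterB P (map f xs)) ≡ length (filterB (P ∘ f) xs)
  length-filterB-map P f [] = refl
  length-filterB-map P f (x ∷ xs) with P (f x)
  ... | true  = cong suc (length-filterB-map P f xs)
  ... | false = length-filterB-map P f xs

  length-filterB-++ˡ : ∀ (P : X → Bool) xs {ys} → All (λ y → ¬ T (P y)) ys →
                       length (filterB P (xs ++ ys)) ≤ length xs
  length-filterB-++ˡ P xs {ys} none = begin
    length (filterB P (xs ++ ys))          ≡⟨ cong length (filterB≗filterᵇ P (xs ++ ys)) ⟩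
    length (filterᵇ P (xs ++ ys))          ≡⟨ cong length (filter-++ (T? ∘ P) xs ys) ⟩
    length (filterᵇ P xs ++ filterᵇ P ys)  ≡⟨ cong (λ zs → length (filterᵇ P xs ++ zs)) (filter-none (T? ∘ P) none) ⟩
    length (filterᵇ P xs ++ [])            ≡⟨ cong length (++-identityʳ (filterᵇ P xs)) ⟩
    length (filterᵇ P xs)                  ≤⟨ length-filter (T? ∘ P) xs ⟩
    length xs                              ∎
    where open ≤-Reasoning

  length-filterB-++ʳ : ∀ (P : X → Bool) {xs} ys → All (λ x → ¬ T (P x)) xs →
                       length (filterB P (xs ++ ys)) ≤ length ys
  length-filterB-++ʳ P {xs} ys none = begin
    length (filterB P (xs ++ ys))          ≡⟨ cong length (filterB≗filterᵇ P (xs ++ ys)) ⟩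
    length (filterᵇ P (xs ++ ys))          ≡⟨ cong length (filter-++ (T? ∘ P) xs ys) ⟩
    length (filterᵇ P xs ++ filterᵇ P ys)  ≡⟨ cong (λ zs → length (zs ++ filterᵇ P ys)) (filter-none (T? ∘ P) none) ⟩
    length (filterᵇ P ys)                  ≤⟨ length-filter (T? ∘ P) ys ⟩
    length ys                              ∎
    where open ≤-Reasoning

  partition₄-↭ : (P₁ P₂ P₃ P₄ : X → Bool) → (∀ x → OneOf₄ (P₁ x) (P₂ x) (P₃ x) (P₄ x)) → ∀ xs →
                 xs ↭ filterB P₁ xs ++ filterB P₂ xs ++ filterB P₃ xs ++ filterB P₄ xs
  partition₄-↭ P₁ P₂ P₃ P₄ one [] = ↭-refl
  partition₄-↭ P₁ P₂ P₃ P₄ one (x ∷ xs)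
    with P₁ x | P₂ x | P₃ x | P₄ x | one x | partition₄-↭ P₁ P₂ P₃ P₄ one xs
  ... | _ | _ | _ | _ | first  | rest = prep x rest
  ... | _ | _ | _ | _ | second | rest = ↭-trans (prep x rest) (↭-sym (shift x _ _))
  ... | _ | _ | _ | _ | third  | rest =
    ↭-trans (prep x rest) (↭-sym (↭-trans (++⁺ˡ (filterB P₁ xs) (shift x _ _)) (shift x _ _)))
  ... | _ | _ | _ | _ | fourth | rest =
    ↭-trans (prep x rest)
      (↭-sym (↭-trans (++⁺ˡ (filterB P₁ xs) (++⁺ˡ (filterB P₂ xs) (shift x _ _)))
             (↭-trans (++⁺ˡ (filterB P₁ xs) (shift x _ _)) (shift x _ _))))

  module _ {R : Rel X 0ℓ} where

    AllPairs-split : ∀ xs {y ys} → AllPairs R (xs ++ y ∷ ys) → All (λ x → R x y) xs × All (R y) ys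
    AllPairs-split []       (Ry ∷ _)     = [] , Ry
    AllPairs-split (x ∷ xs) (Rx ∷ pairs) =
      (All.head (All.++⁻ʳ xs Rx) ∷ proj₁ (AllPairs-split xs pairs)) , proj₂ (AllPairs-split xs pairs)

    AllPairs-++⁻ : ∀ xs {ys} → AllPairs R (xs ++ ys) → AllPairs R xs × AllPairs R ys
    AllPairs-++⁻ []       pairs        = [] , pairs
    AllPairs-++⁻ (x ∷ xs) (Rx ∷ pairs) =
      (All.++⁻ˡ xs Rx ∷ proj₁ (AllPairs-++⁻ xs pairs)) , proj₂ (AllPairs-++⁻ xs pairs)

    AllPairs-resp-↭ : Symmetric R → ∀ {xs ys} → xs ↭ ys → AllPairs R xs → AllPairs R ys
    AllPairs-resp-↭ sym = Permₛ.AllPairs-resp-↭ (setoid X) sym (resp₂ R) ∘ ↭⇒↭ₛ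

module _ (O : DecTotalOrder 0ℓ 0ℓ 0ℓ) where
  open DecTotalOrder O using (totalOrder) renaming (Carrier to X; _≤_ to _≼_; _≤?_ to _≼?_)
  open import Data.List.Sort.InsertionSort.Base O using (insert; sort)
  open import Data.List.Sort.InsertionSort.Properties O using (sort-↭; sort-↗)

  private
    le : X → X → Bool
    le x y = does (x ≼? y)

  isortB≗sort : ∀ xs → isortB le xs ≡ sort xs
  isortB≗sort []       = refl
  isortB≗sort (x ∷ xs) = trans (insertB≗insert (isortB le xs)) (cong (insert x) (isortB≗sort xs))
    where
    insertB≗insert : ∀ ys → insertB le x ys ≡ insert x ys
    insertB≗insert [] = refl
    insertB≗insert (y ∷ ys) with le x y
    ... | true  = refl
    ... | false = cong (y ∷_) (insertB≗insert ys)

  isortB-↭ : ∀ xs → isortB le xs ↭ xs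
  isortB-↭ xs = ↭-trans (↭-reflexive (isortB≗sort xs)) (sort-↭ xs)

  isortB-split : ∀ xs {ys y zs} → isortB le xs ≡ ys ++ y ∷ zs → All (_≼ y) ys × All (y ≼_) zs
  isortB-split xs {ys} sorted =
    AllPairs-split ys (subst (AllPairs _≼_) (trans (sym (isortB≗sort xs)) sorted)
                             (Sorted⇒AllPairs totalOrder (sort-↗ xs)))

-- Trees

mutual
  contents : {A : Set} → Tree A → List (Altered A)
  contents (leaf S) = S
  contents (node p t₁ t₂ t₃ t₄ ts) =
    p ∷ contents t₁ ++ contents t₂ ++ contents t₃ ++ contents t₄ ++ alteredContents ts

  alteredContents : {A : Set} → Maybe (Tree A × Tree A × Tree A) → List (Altered A)
  alteredContents nothing               = []
  alteredContents (just (u₁ , u₂ , u₃)) = contents u₁ ++ contents u₂ ++ contents u₃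

module _ {A : Set} (w : Altered A → ℕ) where

  Σ-contents-node : ∀ p t₁ t₂ t₃ t₄ ts →
    Σ⟨ w ⟩ (contents (node p t₁ t₂ t₃ t₄ ts)) ≡
    w p + Σ⟨ w ⟩ (contents t₁) + Σ⟨ w ⟩ (contents t₂) + Σ⟨ w ⟩ (contents t₃) + Σ⟨ w ⟩ (contents t₄)
        + Σ⟨ w ⟩ (alteredContents ts)
  Σ-contents-node p t₁ t₂ t₃ t₄ ts = begin
    w p + Σ⟨ w ⟩ (c₁ ++ c₂ ++ c₃ ++ c₄ ++ cs)
      ≡⟨ cong (w p +_) (trans (Σ-++ w c₁ _) (cong (Σ⟨ w ⟩ c₁ +_) (trans (Σ-++ w c₂ _)
           (cong (Σ⟨ w ⟩ c₂ +_) (trans (Σ-++ w c₃ _) (cong (Σ⟨ w ⟩ c₃ +_) (Σ-++ w c₄ cs))))))) ⟩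
    w p + (Σ⟨ w ⟩ c₁ + (Σ⟨ w ⟩ c₂ + (Σ⟨ w ⟩ c₃ + (Σ⟨ w ⟩ c₄ + Σ⟨ w ⟩ cs))))
      ≡⟨ reassoc (w p) (Σ⟨ w ⟩ c₁) (Σ⟨ w ⟩ c₂) (Σ⟨ w ⟩ c₃) (Σ⟨ w ⟩ c₄) (Σ⟨ w ⟩ cs) ⟩
    w p + Σ⟨ w ⟩ c₁ + Σ⟨ w ⟩ c₂ + Σ⟨ w ⟩ c₃ + Σ⟨ w ⟩ c₄ + Σ⟨ w ⟩ cs ∎
    where
    open ≡-Reasoning
    c₁ = contents t₁
    c₂ = contents t₂
    c₃ = contents t₃
    c₄ = contents t₄
    cs = alteredContents ts
    reassoc : ∀ a b c d e f → a + (b + (c + (d + (e + f)))) ≡ a + b + c + d + e + f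
    reassoc = solve-∀

  Σ-alteredContents : ∀ u₁ u₂ u₃ →
    Σ⟨ w ⟩ (alteredContents (just (u₁ , u₂ , u₃))) ≡
    Σ⟨ w ⟩ (contents u₁) + Σ⟨ w ⟩ (contents u₂) + Σ⟨ w ⟩ (contents u₃)
  Σ-alteredContents u₁ u₂ u₃ =
    trans (trans (Σ-++ w (contents u₁) _) (cong (Σ⟨ w ⟩ (contents u₁) +_) (Σ-++ w (contents u₂) _)))
          (sym (+-assoc (Σ⟨ w ⟩ (contents u₁)) _ _))

module CGLSpace {A : Set} (_<A_ : Rel A 0ℓ) (sto : IsStrictTotalOrder _≡_ _<A_)
                (dollar : A) (text : List A) (k : ℕ) where

  open CGL _<A_ sto dollar text k
  open IsStrictTotalOrder sto using (compare)

  -- The lexicographic order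

  private
    module ListLex = IsStrictTotalOrder (Lex-<-isStrictTotalOrder sto)

  lexLt⇒Lex-< : ∀ xs ys → T (lexLt xs ys) → Lex-< _≡_ _<A_ xs ys
  lexLt⇒Lex-< []       (y ∷ ys) _  = halt
  lexLt⇒Lex-< (x ∷ xs) (y ∷ ys) lt with compare x y
  ... | tri< x<y _ _ = this x<y
  ... | tri≈ _ x≡y _ = next x≡y (lexLt⇒Lex-< xs ys lt)

  Lex-<⇒lexLt : ∀ {xs ys} → Lex-< _≡_ _<A_ xs ys → T (lexLt xs ys)
  Lex-<⇒lexLt halt = tt
  Lex-<⇒lexLt {x ∷ _} {y ∷ _} (this x<y) with compare x y
  ... | tri< _ _ _   = tt
  ... | tri≈ x≮y _ _ = ⊥-elim (x≮y x<y)
  ... | tri> x≮y _ _ = ⊥-elim (x≮y x<y)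
  Lex-<⇒lexLt {x ∷ _} {y ∷ _} (next x≡y xs<ys) with compare x y
  ... | tri< _ _ _   = tt
  ... | tri≈ _ _ _   = Lex-<⇒lexLt xs<ys
  ... | tri> _ x≢y _ = ⊥-elim (x≢y x≡y)

  lexLt-irrefl : ∀ xs → ¬ T (lexLt xs xs)
  lexLt-irrefl xs = ListLex.irrefl (≡⇒Pointwise-≡ refl) ∘ lexLt⇒Lex-< xs xs

  lexLt-trans : ∀ xs ys zs → T (lexLt xs ys) → T (lexLt ys zs) → T (lexLt xs zs)
  lexLt-trans xs ys zs xs<ys ys<zs =
    Lex-<⇒lexLt (ListLex.trans (lexLt⇒Lex-< xs ys xs<ys) (lexLt⇒Lex-< ys zs ys<zs))

  lexLt-compare : ∀ xs ys → Tri (T (lexLt xs ys)) (xs ≡ ys) (T (lexLt ys xs))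
  lexLt-compare xs ys with ListLex.compare xs ys
  ... | tri< a b c = tri< (Lex-<⇒lexLt a) (b ∘ ≡⇒Pointwise-≡) (c ∘ lexLt⇒Lex-< ys xs)
  ... | tri≈ a b c = tri≈ (a ∘ lexLt⇒Lex-< xs ys) (Pointwise-≡⇒≡ b) (c ∘ lexLt⇒Lex-< ys xs)
  ... | tri> a b c = tri> (a ∘ lexLt⇒Lex-< xs ys) (b ∘ ≡⇒Pointwise-≡) (Lex-<⇒lexLt c)

  -- xs ≤ ys is ¬ (ys < xs), so that does (s ≤? t) in alteredOrder is lexLe s t on the nose
  -- and isortB lexLe is the library's insertion sort.
  lexOrder : DecTotalOrder 0ℓ 0ℓ 0ℓ
  lexOrder = record
    { Carrier = List A
    ; _≈_ = _≡_
    ; _≤_ = λ xs ys → ¬ T (lexLt ys xs)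
    ; isDecTotalOrder = record
      { isTotalOrder = record
        { isPartialOrder = record
          { isPreorder = record
            { isEquivalence = isEquivalence
            ; reflexive = λ { {xs} refl → lexLt-irrefl xs }
            ; trans = λ {xs} {ys} {zs} → ≤-trans′ xs ys zs
            }
          ; antisym = λ {xs} {ys} → antisym′ xs ys
          }
        ; total = total′
        }
      ; _≟_ = ≡-dec (IsStrictTotalOrder._≟_ sto)
      ; _≤?_ = λ xs ys → ¬? (T? (lexLt ys xs))
      }
    }
    where
    ≤-trans′ : ∀ xs ys zs → ¬ T (lexLt ys xs) → ¬ T (lexLt zs ys) → ¬ T (lexLt zs xs)
    ≤-trans′ xs ys zs ys≮xs zs≮ys zs<xs with lexLt-compare xs ys
    ... | tri< xs<ys _ _ = zs≮ys (lexLt-trans zs xs ys zs<xs xs<ys)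
    ... | tri≈ _ refl _  = zs≮ys zs<xs
    ... | tri> _ _ ys<xs = ys≮xs ys<xs
    antisym′ : ∀ xs ys → ¬ T (lexLt ys xs) → ¬ T (lexLt xs ys) → xs ≡ ys
    antisym′ xs ys ys≮xs xs≮ys with lexLt-compare xs ys
    ... | tri< xs<ys _ _ = ⊥-elim (xs≮ys xs<ys)
    ... | tri≈ _ xs≡ys _ = xs≡ys
    ... | tri> _ _ ys<xs = ⊥-elim (ys≮xs ys<xs)
    total′ : ∀ xs ys → ¬ T (lexLt ys xs) ⊎ ¬ T (lexLt xs ys)
    total′ xs ys with lexLt-compare xs ys
    ... | tri< _ _ ys≮xs = inj₁ ys≮xs
    ... | tri≈ _ _ ys≮xs = inj₁ ys≮xs
    ... | tri> xs≮ys _ _ = inj₂ xs≮ys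

  alteredOrder : DecTotalOrder 0ℓ 0ℓ 0ℓ
  alteredOrder = On.decTotalOrder lexOrder str

  -- One step of RecursiveCGL

  len : Altered A → ℕ
  len s = length (str s)

  -- Pivot-altering can make two strings equal, but never two strings of different lengths.
  Distinct : List (Altered A) → Set
  Distinct = AllPairs (λ s t → len s ≢ len t)

  Distinct-resp-↭ : ∀ {xs ys} → xs ↭ ys → Distinct xs → Distinct ys
  Distinct-resp-↭ = AllPairs-resp-↭ (λ s≢t → s≢t ∘ sym)

  length-applyAlts : ∀ xs as → length (applyAlts xs as) ≡ length xs
  length-applyAlts xs []             = refl
  length-applyAlts xs ((i , c) ∷ as) = trans (length-applyAlts (setAt xs i c) as) (length-setAt xs i c)

  start-pivotAlter : ∀ p s → start (pivotAlter p s) ≡ start s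
  start-pivotAlter p s with nth? (str p) (LCP s p)
  ... | nothing = refl
  ... | just _  = refl

  len-pivotAlter : ∀ p s → len (pivotAlter p s) ≡ len s
  len-pivotAlter p s with nth? (str p) (LCP s p)
  ... | nothing = refl
  ... | just c  = trans (length-applyAlts (drop (start s) T$) (alts s ++ (LCP s p , c) ∷ []))
                        (sym (length-applyAlts (drop (start s) T$) (alts s)))

  record Splits (S : List (Altered A)) (p : Altered A) (S₁ S₂ S₃ S₄ : List (Altered A)) : Set where
    field
      nontrivial  : 1 < length S
      permutation : S ↭ p ∷ S₁ ++ S₂ ++ S₃ ++ S₄
      halving     : Distinct S → All (λ X → 2 * length X ≤ length S) (S₁ ∷ S₂ ∷ S₃ ∷ S₄ ∷ [])

  module Pivoting (S before : List (Altered A)) (p : Altered A) (after : List (Altered A)) where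

    lcpₚ : Altered A → ℕ
    lcpₚ s = LCP s p

    m : ℕ
    m = nth 0 (isortB _≤ᵇ_ (map lcpₚ S)) (medIdx (length S))

    others : List (Altered A)
    others = before ++ after

    in<m in<ℓ in>ℓ in>m : Altered A → Bool
    in<m s = lcpₚ s <ᵇ m
    in<ℓ s = (lcpₚ s ≡ᵇ m) ∧ lexLt (str s) (str p)
    in>ℓ s = (lcpₚ s ≡ᵇ m) ∧ not (lexLt (str s) (str p))
    in>m s = m <ᵇ lcpₚ s

    S<m S<ℓ S>ℓ S>m : List (Altered A)
    S<m = filterB in<m others
    S<ℓ = filterB in<ℓ others
    S>ℓ = filterB in>ℓ others
    S>m = filterB in>m others

    module _ (sorted : isortB lexLe S ≡ before ++ p ∷ after) (median : length before ≡ medIdx (length S)) where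

      S↭sorted : S ↭ before ++ p ∷ after
      S↭sorted = ↭-trans (↭-sym (isortB-↭ alteredOrder S)) (↭-reflexive sorted)

      S↭p∷others : S ↭ p ∷ others
      S↭p∷others = ↭-trans S↭sorted (shift p before after)

      length-S : length before + suc (length after) ≡ length S
      length-S = trans (sym (length-++ before)) (sym (↭-length S↭sorted))

      permutation : S ↭ p ∷ S<m ++ S<ℓ ++ S>ℓ ++ S>m
      permutation = ↭-trans S↭p∷others (prep p (partition₄-↭ in<m in<ℓ in>ℓ in>m
                      (λ s → oneOf₄-compare (lcpₚ s) m (lexLt (str s) (str p))) others))

      S<ℓ≤before : length S<ℓ ≤ length before
      S<ℓ≤before = length-filterB-++ˡ in<ℓ before
        (All.map (λ s≮p → s≮p ∘ proj₂ ∘ Equivalence.to T-∧) (proj₂ (isortB-split alteredOrder S sorted)))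

      S>ℓ≤after : Distinct S → length S>ℓ ≤ length after
      S>ℓ≤after distinct = length-filterB-++ʳ in>ℓ after
        (All.map (λ {s} → ∉S>ℓ s) (All.zip (proj₁ (isortB-split alteredOrder S sorted) , lengths≢)))
        where
        lengths≢ : All (λ s → len s ≢ len p) before
        lengths≢ = proj₁ (AllPairs-split before (Distinct-resp-↭ S↭sorted distinct))
        ∉S>ℓ : ∀ s → ¬ T (lexLt (str p) (str s)) × len s ≢ len p → ¬ T (in>ℓ s)
        ∉S>ℓ s (p≮s , s≢p) with lexLt-compare (str s) (str p)
        ... | tri< s<p _ _ = T⇒¬T-∧-not (lcpₚ s ≡ᵇ m) s<p
        ... | tri≈ _ s≡p _ = ⊥-elim (s≢p (cong length s≡p))
        ... | tri> _ _ p<s = ⊥-elim (p≮s p<s)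

      W : List ℕ
      W = isortB _≤ᵇ_ (map lcpₚ S)

      length-W : length W ≡ length S
      length-W = trans (↭-length (isortB-↭ ≤-decTotalOrder (map lcpₚ S))) (length-map lcpₚ S)

      count≤count-in-W : ∀ Q → length (filterB (Q ∘ lcpₚ) others) ≤ length (filterB Q W)
      count≤count-in-W Q = begin
        length (filterB (Q ∘ lcpₚ) others)       ≤⟨ length-filterB-∷ (Q ∘ lcpₚ) p others ⟩
        length (filterB (Q ∘ lcpₚ) (p ∷ others)) ≡⟨ ↭-length (filterB-↭ (Q ∘ lcpₚ) (↭-sym S↭p∷others)) ⟩
        length (filterB (Q ∘ lcpₚ) S)            ≡⟨ sym (length-filterB-map Q lcpₚ S) ⟩
        length (filterB Q (map lcpₚ S))
          ≡⟨ ↭-length (filterB-↭ Q (↭-sym (isortB-↭ ≤-decTotalOrder (map lcpₚ S)))) ⟩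
        length (filterB Q W)                     ∎
        where open ≤-Reasoning

      lcp-halving : ∀ bw aw → W ≡ bw ++ m ∷ aw → length bw ≡ medIdx (length S) →
                    2 * length S<m ≤ length S × 2 * length S>m ≤ length S
      lcp-halving bw aw W≡ median-W =
        ≤-trans (*-monoʳ-≤ 2 (≤-trans (count≤count-in-W (_<ᵇ m)) S<m-count)) (proj₁ W-halves) ,
        ≤-trans (*-monoʳ-≤ 2 (≤-trans (count≤count-in-W (m <ᵇ_)) S>m-count)) (proj₂ W-halves)
        where
        W-halves = medIdx-halves (trans (sym (length-++ bw)) (trans (cong length (sym W≡)) length-W)) median-W
        W-sorted = isortB-split ≤-decTotalOrder (map lcpₚ S) W≡
        S<m-count : length (filterB (_<ᵇ m) W) ≤ length bw
        S<m-count = subst (λ xs → length (filterB (_<ᵇ m) xs) ≤ length bw) (sym W≡)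
          (length-filterB-++ˡ (_<ᵇ m) bw (All.map ≤⇒¬<ᵇ (≤-refl ∷ proj₂ W-sorted)))
        S>m-count : length (filterB (m <ᵇ_) W) ≤ length aw
        S>m-count = subst (λ xs → length (filterB (m <ᵇ_) xs) ≤ length aw) (trans (++-assoc bw [ m ] aw) (sym W≡))
          (length-filterB-++ʳ (m <ᵇ_) aw (All.++⁺ (All.map ≤⇒¬<ᵇ (proj₁ W-sorted)) (≤⇒¬<ᵇ (≤-refl {m}) ∷ [])))

      median<|W| : medIdx (length S) < length W
      median<|W| = subst₂ _<_ median (trans length-S (sym length-W)) (m<m+n (length before) z<s)

      halving : Distinct S → All (λ X → 2 * length X ≤ length S) (S<m ∷ S<ℓ ∷ S>ℓ ∷ S>m ∷ [])
      halving distinct with nth-split 0 W (medIdx (length S)) median<|W|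
      ... | bw , aw , W≡ , median-W with lcp-halving bw aw W≡ median-W
      ... | S<m-half , S>m-half =
        S<m-half ∷ ≤-trans (*-monoʳ-≤ 2 S<ℓ≤before) (proj₁ halves)
                 ∷ ≤-trans (*-monoʳ-≤ 2 (S>ℓ≤after distinct)) (proj₂ halves) ∷ S>m-half ∷ []
        where halves = medIdx-halves length-S median

    splits : pick (medIdx (length S)) (isortB lexLe S) ≡ just (before , p , after) →
             (length S ≤ᵇ 1) ≡ false → Splits S p S<m S<ℓ S>ℓ S>m
    splits picked long = record
      { nontrivial  = ≰⇒> (λ S≤1 → subst T long (≤⇒≤ᵇ S≤1))
      ; permutation = permutation sorted median
      ; halving     = halving sorted median
      }
      where
      sorted = proj₁ (pick-split (medIdx (length S)) (isortB lexLe S) picked)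
      median = proj₂ (pick-split (medIdx (length S)) (isortB lexLe S) picked)

  -- The local hatTrees of build, as a top-level function.
  alteredChildren : ℕ → ℕ → Altered A → (S₁ S₂ S₃ : List (Altered A)) → Maybe (Tree A × Tree A × Tree A)
  alteredChildren f zero    p S₁ S₂ S₃ = nothing
  alteredChildren f (suc j) p S₁ S₂ S₃ =
    just (build f j (map (pivotAlter p) S₁) , build f j (map (pivotAlter p) S₂) , build f j (map (pivotAlter p) S₃))

  data Unfolding (f j : ℕ) (S : List (Altered A)) : Tree A → Set where
    stop  : Unfolding f j S (leaf S)
    split : ∀ {p S₁ S₂ S₃ S₄} → Splits S p S₁ S₂ S₃ S₄ →
            Unfolding f j S (node p (build f j S₁) (build f j S₂) (build f j S₃) (build f j S₄)
                                  (alteredChildren f j p S₁ S₂ S₃))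

  -- j is split only so that hatTrees j reduces.
  unfold : ∀ f j S → Unfolding f j S (build (suc f) j S)
  unfold f j S with length S ≤ᵇ 1 in long
  ... | true  = stop
  ... | false with pick (medIdx (length S)) (isortB lexLe S) in picked
  unfold f j       S | false | nothing                   = stop
  unfold f zero    S | false | just (before , p , after) = split (Pivoting.splits S before p after picked long)
  unfold f (suc j) S | false | just (before , p , after) = split (Pivoting.splits S before p after picked long)

  module _ {S p S₁ S₂ S₃ S₄} (sp : Splits S p S₁ S₂ S₃ S₄) where
    open Splits sp

    All-parts : ∀ {P : Altered A → Set} → All P S → P p × All (All P) (S₁ ∷ S₂ ∷ S₃ ∷ S₄ ∷ [])
    All-parts all with All-resp-↭ permutation all
    ... | Pp ∷ rest =
      Pp , All.++⁻ˡ S₁ rest ∷ All.++⁻ˡ S₂ rest₂ ∷ All.++⁻ˡ S₃ rest₃ ∷ All.++⁻ʳ S₃ rest₃ ∷ []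
      where
      rest₂ = All.++⁻ʳ S₁ rest
      rest₃ = All.++⁻ʳ S₂ rest₂

    Distinct-parts : Distinct S → All Distinct (S₁ ∷ S₂ ∷ S₃ ∷ S₄ ∷ [])
    Distinct-parts distinct with Distinct-resp-↭ permutation distinct
    ... | _ ∷ rest = proj₁ (AllPairs-++⁻ S₁ rest) ∷ proj₁ (AllPairs-++⁻ S₂ rest₂)
                   ∷ proj₁ (AllPairs-++⁻ S₃ rest₃) ∷ proj₂ (AllPairs-++⁻ S₃ rest₃) ∷ []
      where
      rest₂ = proj₂ (AllPairs-++⁻ S₁ rest)
      rest₃ = proj₂ (AllPairs-++⁻ S₂ rest₂)

    Σ-parts : ∀ w → Σ⟨ w ⟩ S ≡ w p + Σ⟨ w ⟩ S₁ + Σ⟨ w ⟩ S₂ + Σ⟨ w ⟩ S₃ + Σ⟨ w ⟩ S₄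
    Σ-parts w = begin
      Σ⟨ w ⟩ S                              ≡⟨ Σ-↭ w permutation ⟩
      w p + Σ⟨ w ⟩ (S₁ ++ S₂ ++ S₃ ++ S₄)
        ≡⟨ cong (w p +_) (trans (Σ-++ w S₁ _) (cong (Σ⟨ w ⟩ S₁ +_)
             (trans (Σ-++ w S₂ _) (cong (Σ⟨ w ⟩ S₂ +_) (Σ-++ w S₃ S₄))))) ⟩
      w p + (Σ⟨ w ⟩ S₁ + (Σ⟨ w ⟩ S₂ + (Σ⟨ w ⟩ S₃ + Σ⟨ w ⟩ S₄)))
        ≡⟨ reassoc (w p) (Σ⟨ w ⟩ S₁) (Σ⟨ w ⟩ S₂) (Σ⟨ w ⟩ S₃) (Σ⟨ w ⟩ S₄) ⟩
      w p + Σ⟨ w ⟩ S₁ + Σ⟨ w ⟩ S₂ + Σ⟨ w ⟩ S₃ + Σ⟨ w ⟩ S₄ ∎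
      where
      open ≡-Reasoning
      reassoc : ∀ a b c d e → a + (b + (c + (d + e))) ≡ a + b + c + d + e
      reassoc = solve-∀

  -- Counting stored strings

  Admissible : ℕ → List (Altered A) → Set
  Admissible h S = Distinct S × length S ≤ 2 ^ h

  admissible-parts : ∀ {h S p S₁ S₂ S₃ S₄} → Splits S p S₁ S₂ S₃ S₄ → Admissible (suc h) S →
                     All (Admissible h) (S₁ ∷ S₂ ∷ S₃ ∷ S₄ ∷ [])
  admissible-parts sp (distinct , small) =
    All.zipWith (λ (d , half) → d , *-cancelˡ-≤ 2 (≤-trans half small))
                (Distinct-parts sp distinct , Splits.halving sp distinct)

  admissible-pivotAlter : ∀ {h S} p → Admissible h S → Admissible h (map (pivotAlter p) S)
  admissible-pivotAlter {S = S} p (distinct , small) =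
    AllPairs.map⁺ (AllPairs.map (λ {s} {t} s≢t → s≢t ∘ subst₂ _≡_ (len-pivotAlter p s) (len-pivotAlter p t)) distinct) ,
    ≤-trans (≤-reflexive (length-map (pivotAlter p) S)) small

  module _ (w : Altered A → ℕ) (w-pivotAlter : ∀ p s → w (pivotAlter p s) ≡ w s) where

    private
      leaf-bound : ∀ S h j → Σ⟨ w ⟩ S ≤ Σ⟨ w ⟩ S * binomSum h (suc j)
      leaf-bound S h j = ≤-trans (≤-reflexive (sym (*-identityʳ _))) (*-monoʳ-≤ (Σ⟨ w ⟩ S) (1≤binomSum h j))

    mutual
      Σ-contents-build : ∀ f j S h → Admissible h S →
                         Σ⟨ w ⟩ (contents (build f j S)) ≤ Σ⟨ w ⟩ S * binomSum h (suc j)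
      Σ-contents-build zero    j S h _ = leaf-bound S h j
      Σ-contents-build (suc f) j S h admissible with build (suc f) j S | unfold f j S
      ... | _ | stop = leaf-bound S h j
      Σ-contents-build (suc f) j S zero    (_ , small) | _ | split sp = ⊥-elim (<⇒≱ (Splits.nontrivial sp) small)
      Σ-contents-build (suc f) j S (suc h) admissible  | _ | split {p} {S₁} {S₂} {S₃} {S₄} sp
        with admissible-parts {h} sp admissible
      ... | a₁ ∷ a₂ ∷ a₃ ∷ a₄ ∷ [] = begin
        Σ⟨ w ⟩ (contents (node p (child S₁) (child S₂) (child S₃) (child S₄) altered))
          ≡⟨ Σ-contents-node w p (child S₁) (child S₂) (child S₃) (child S₄) altered ⟩
        w p + Σ⟨ w ⟩ (contents (child S₁)) + Σ⟨ w ⟩ (contents (child S₂)) + Σ⟨ w ⟩ (contents (child S₃))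
            + Σ⟨ w ⟩ (contents (child S₄)) + Σ⟨ w ⟩ (alteredContents altered)
          ≤⟨ node-arith (w p) (Σ⟨ w ⟩ S₁) (Σ⟨ w ⟩ S₂) (Σ⟨ w ⟩ S₃) (Σ⟨ w ⟩ S₄) _ _ (1≤binomSum h j)
               (Σ-contents-build f j S₁ h a₁) (Σ-contents-build f j S₂ h a₂)
               (Σ-contents-build f j S₃ h a₃) (Σ-contents-build f j S₄ h a₄)
               (Σ-alteredContents-build f j p h a₁ a₂ a₃) ⟩
        (w p + Σ⟨ w ⟩ S₁ + Σ⟨ w ⟩ S₂ + Σ⟨ w ⟩ S₃ + Σ⟨ w ⟩ S₄) * (binomSum h (suc j) + binomSum h j)
          ≡⟨ cong₂ _*_ (sym (Σ-parts sp w)) (sym (binomSum-pascal h j)) ⟩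
        Σ⟨ w ⟩ S * binomSum (suc h) (suc j) ∎
        where
        open ≤-Reasoning
        child : List (Altered A) → Tree A
        child = build f j
        altered = alteredChildren f j p S₁ S₂ S₃

      Σ-alteredContents-build : ∀ f j p h {S₁ S₂ S₃} → Admissible h S₁ → Admissible h S₂ → Admissible h S₃ →
        Σ⟨ w ⟩ (alteredContents (alteredChildren f j p S₁ S₂ S₃)) ≤
        (Σ⟨ w ⟩ S₁ + Σ⟨ w ⟩ S₂ + Σ⟨ w ⟩ S₃) * binomSum h j
      Σ-alteredContents-build f zero    p h _ _ _ = z≤n
      Σ-alteredContents-build f (suc j) p h {S₁} {S₂} {S₃} a₁ a₂ a₃ = begin
        Σ⟨ w ⟩ (alteredContents (just (altered S₁ , altered S₂ , altered S₃)))
          ≡⟨ Σ-alteredContents w (altered S₁) (altered S₂) (altered S₃) ⟩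
        Σ⟨ w ⟩ (contents (altered S₁)) + Σ⟨ w ⟩ (contents (altered S₂)) + Σ⟨ w ⟩ (contents (altered S₃))
          ≤⟨ +-mono-≤ (+-mono-≤ (altered-bound a₁) (altered-bound a₂)) (altered-bound a₃) ⟩
        Σ⟨ w ⟩ S₁ * binomSum h (suc j) + Σ⟨ w ⟩ S₂ * binomSum h (suc j) + Σ⟨ w ⟩ S₃ * binomSum h (suc j)
          ≡⟨ distribute (Σ⟨ w ⟩ S₁) (Σ⟨ w ⟩ S₂) (Σ⟨ w ⟩ S₃) (binomSum h (suc j)) ⟩
        (Σ⟨ w ⟩ S₁ + Σ⟨ w ⟩ S₂ + Σ⟨ w ⟩ S₃) * binomSum h (suc j) ∎
        where
        open ≤-Reasoning
        altered : List (Altered A) → Tree A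
        altered X = build f j (map (pivotAlter p) X)
        altered-bound : ∀ {X} → Admissible h X → Σ⟨ w ⟩ (contents (altered X)) ≤ Σ⟨ w ⟩ X * binomSum h (suc j)
        altered-bound {X} a = subst (λ v → Σ⟨ w ⟩ (contents (altered X)) ≤ v * binomSum h (suc j))
                                (Σ-map w (pivotAlter p) (w-pivotAlter p) X)
                                (Σ-contents-build f j (map (pivotAlter p) X) h (admissible-pivotAlter {h} p a))
        distribute : ∀ a b c d → a * d + b * d + c * d ≡ (a + b + c) * d
        distribute = solve-∀

  Budget : ℕ → Altered A → Set
  Budget j s = length (alts s) + j ≤ k

  budget⇒alts≤k : ∀ {j} s → Budget j s → length (alts s) ≤ k
  budget⇒alts≤k {j} s = ≤-trans (m≤m+n (length (alts s)) j)

  budget-pivotAlter : ∀ {j} p s → Budget (suc j) s → Budget j (pivotAlter p s)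
  budget-pivotAlter {j} p s budget with nth? (str p) (LCP s p)
  ... | nothing = ≤-trans (+-monoʳ-≤ (length (alts s)) (n≤1+n j)) budget
  ... | just c  = subst (_≤ k) (sym (trans (cong (_+ j) (length-++ (alts s))) (+-assoc (length (alts s)) 1 j))) budget

  mutual
    contents-budget : ∀ f j S → All (Budget j) S → All (λ s → length (alts s) ≤ k) (contents (build f j S))
    contents-budget zero    j S budget = All.map (λ {s} → budget⇒alts≤k s) budget
    contents-budget (suc f) j S budget with build (suc f) j S | unfold f j S
    ... | _ | stop = All.map (λ {s} → budget⇒alts≤k s) budget
    ... | _ | split {p} {S₁} {S₂} {S₃} {S₄} sp with All-parts sp budget
    ...   | budget-p , b₁ ∷ b₂ ∷ b₃ ∷ b₄ ∷ [] =
      budget⇒alts≤k p budget-p ∷ All.++⁺ (contents-budget f j S₁ b₁) (All.++⁺ (contents-budget f j S₂ b₂)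
        (All.++⁺ (contents-budget f j S₃ b₃) (All.++⁺ (contents-budget f j S₄ b₄)
          (alteredContents-budget f j p b₁ b₂ b₃))))

    alteredContents-budget : ∀ f j p {S₁ S₂ S₃} → All (Budget j) S₁ → All (Budget j) S₂ → All (Budget j) S₃ →
      All (λ s → length (alts s) ≤ k) (alteredContents (alteredChildren f j p S₁ S₂ S₃))
    alteredContents-budget f zero    p _  _  _  = []
    alteredContents-budget f (suc j) p b₁ b₂ b₃ = All.++⁺ (altered b₁) (All.++⁺ (altered b₂) (altered b₃))
      where
      altered : ∀ {X} → All (Budget (suc j)) X →
                All (λ s → length (alts s) ≤ k) (contents (build f j (map (pivotAlter p) X)))
      altered {X} b = contents-budget f j (map (pivotAlter p) X) (All.map⁺ (All.map (λ {s} → budget-pivotAlter p s) b))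

  startsAt : ℕ → Altered A → ℕ
  startsAt i s = indicator i (start s)

  pivotCount≤Σ : ∀ i t → pivotCount i t ≤ Σ⟨ startsAt i ⟩ (contents t)
  pivotCount≤Σ i (leaf S) = z≤n
  pivotCount≤Σ i (node p t₁ t₂ t₃ t₄ nothing) =
    ≤-trans (+-mono₅ (pivotCount≤Σ i t₁) (pivotCount≤Σ i t₂) (pivotCount≤Σ i t₃) (pivotCount≤Σ i t₄) z≤n)
            (≤-reflexive (sym (Σ-contents-node (startsAt i) p t₁ t₂ t₃ t₄ nothing)))
  pivotCount≤Σ i (node p t₁ t₂ t₃ t₄ (just (u₁ , u₂ , u₃))) =
    ≤-trans (+-mono₅ (pivotCount≤Σ i t₁) (pivotCount≤Σ i t₂) (pivotCount≤Σ i t₃) (pivotCount≤Σ i t₄)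
                     (≤-trans (+-mono-≤ (+-mono-≤ (pivotCount≤Σ i u₁) (pivotCount≤Σ i u₂)) (pivotCount≤Σ i u₃))
                              (≤-reflexive (sym (Σ-alteredContents (startsAt i) u₁ u₂ u₃)))))
            (≤-reflexive (sym (Σ-contents-node (startsAt i) p t₁ t₂ t₃ t₄ (just (u₁ , u₂ , u₃)))))

  -- Each pivot also pays for the child pointers of its node and for the + 1 of its children's bounds.
  cost : Altered A → ℕ
  cost s = altWords s + 14

  treeWords≤Σ : ∀ t → treeWords t ≤ Σ⟨ cost ⟩ (contents t) + 1
  treeWords≤Σ (leaf S) = begin
    1 + sum (map altWords S)  ≡⟨ +-comm 1 _ ⟩
    Σ⟨ altWords ⟩ S + 1       ≤⟨ +-monoˡ-≤ 1 (Σ-mono (All.universal (λ s → m≤m+n (altWords s) 14) S)) ⟩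
    Σ⟨ cost ⟩ S + 1           ∎
    where open ≤-Reasoning
  treeWords≤Σ (node p t₁ t₂ t₃ t₄ nothing) = begin
    altWords p + 4 + treeWords t₁ + treeWords t₂ + treeWords t₃ + treeWords t₄
      ≤⟨ +-mono-≤ (+-mono-≤ (+-mono-≤ (+-monoʳ-≤ (altWords p + 4) (treeWords≤Σ t₁)) (treeWords≤Σ t₂))
                            (treeWords≤Σ t₃)) (treeWords≤Σ t₄) ⟩
    altWords p + 4 + (Σ⟨ cost ⟩ c₁ + 1) + (Σ⟨ cost ⟩ c₂ + 1) + (Σ⟨ cost ⟩ c₃ + 1) + (Σ⟨ cost ⟩ c₄ + 1)
      ≤⟨ m≤m+n _ 7 ⟩
    altWords p + 4 + (Σ⟨ cost ⟩ c₁ + 1) + (Σ⟨ cost ⟩ c₂ + 1) + (Σ⟨ cost ⟩ c₃ + 1) + (Σ⟨ cost ⟩ c₄ + 1) + 7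
      ≡⟨ regroup (altWords p) (Σ⟨ cost ⟩ c₁) (Σ⟨ cost ⟩ c₂) (Σ⟨ cost ⟩ c₃) (Σ⟨ cost ⟩ c₄) ⟩
    cost p + Σ⟨ cost ⟩ c₁ + Σ⟨ cost ⟩ c₂ + Σ⟨ cost ⟩ c₃ + Σ⟨ cost ⟩ c₄ + 0 + 1
      ≡⟨ cong (_+ 1) (sym (Σ-contents-node cost p t₁ t₂ t₃ t₄ nothing)) ⟩
    Σ⟨ cost ⟩ (contents (node p t₁ t₂ t₃ t₄ nothing)) + 1 ∎
    where
    open ≤-Reasoning
    c₁ = contents t₁
    c₂ = contents t₂
    c₃ = contents t₃
    c₄ = contents t₄
    regroup : ∀ a b₁ b₂ b₃ b₄ →
      a + 4 + (b₁ + 1) + (b₂ + 1) + (b₃ + 1) + (b₄ + 1) + 7 ≡ a + 14 + b₁ + b₂ + b₃ + b₄ + 0 + 1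
    regroup = solve-∀
  treeWords≤Σ (node p t₁ t₂ t₃ t₄ (just (u₁ , u₂ , u₃))) = begin
    altWords p + 7 + treeWords t₁ + treeWords t₂ + treeWords t₃ + treeWords t₄
      + treeWords u₁ + treeWords u₂ + treeWords u₃
      ≤⟨ +-mono-≤ (+-mono-≤ (+-mono₅ (treeWords≤Σ t₁) (treeWords≤Σ t₂) (treeWords≤Σ t₃) (treeWords≤Σ t₄)
                                     (treeWords≤Σ u₁)) (treeWords≤Σ u₂)) (treeWords≤Σ u₃) ⟩
    altWords p + 7 + (Σ⟨ cost ⟩ c₁ + 1) + (Σ⟨ cost ⟩ c₂ + 1) + (Σ⟨ cost ⟩ c₃ + 1) + (Σ⟨ cost ⟩ c₄ + 1)
      + (Σ⟨ cost ⟩ d₁ + 1) + (Σ⟨ cost ⟩ d₂ + 1) + (Σ⟨ cost ⟩ d₃ + 1)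
      ≡⟨ regroup (altWords p) (Σ⟨ cost ⟩ c₁) (Σ⟨ cost ⟩ c₂) (Σ⟨ cost ⟩ c₃) (Σ⟨ cost ⟩ c₄)
                 (Σ⟨ cost ⟩ d₁) (Σ⟨ cost ⟩ d₂) (Σ⟨ cost ⟩ d₃) ⟩
    parent + (Σ⟨ cost ⟩ d₁ + Σ⟨ cost ⟩ d₂ + Σ⟨ cost ⟩ d₃)
      ≤⟨ m≤m+n _ 1 ⟩
    parent + (Σ⟨ cost ⟩ d₁ + Σ⟨ cost ⟩ d₂ + Σ⟨ cost ⟩ d₃) + 1
      ≡⟨ cong (_+ 1) (sym (trans (Σ-contents-node cost p t₁ t₂ t₃ t₄ (just (u₁ , u₂ , u₃)))
                                  (cong (parent +_) (Σ-alteredContents cost u₁ u₂ u₃)))) ⟩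
    Σ⟨ cost ⟩ (contents (node p t₁ t₂ t₃ t₄ (just (u₁ , u₂ , u₃)))) + 1 ∎
    where
    open ≤-Reasoning
    c₁ = contents t₁
    c₂ = contents t₂
    c₃ = contents t₃
    c₄ = contents t₄
    d₁ = contents u₁
    d₂ = contents u₂
    d₃ = contents u₃
    parent = cost p + Σ⟨ cost ⟩ c₁ + Σ⟨ cost ⟩ c₂ + Σ⟨ cost ⟩ c₃ + Σ⟨ cost ⟩ c₄
    regroup : ∀ a b₁ b₂ b₃ b₄ e₁ e₂ e₃ →
      a + 7 + (b₁ + 1) + (b₂ + 1) + (b₃ + 1) + (b₄ + 1) + (e₁ + 1) + (e₂ + 1) + (e₃ + 1)
      ≡ a + 14 + b₁ + b₂ + b₃ + b₄ + (e₁ + e₂ + e₃)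
    regroup = solve-∀

  length-suffixes : length suffixes ≡ n
  length-suffixes = trans (length-map _ (upTo n)) (length-upTo n)

  suffixes-admissible : Admissible ⌈log₂ n ⌉ suffixes
  suffixes-admissible =
    AllPairs.map⁺ (AllPairs.applyUpTo⁺₁ id n different-lengths) ,
    ≤-trans (≤-reflexive length-suffixes) (n≤2^⌈log₂n⌉ n)
    where
    n≤|T$| : n ≤ length T$
    n≤|T$| = ≤-trans (m≤m+n n _) (≤-reflexive (sym (length-++ text)))
    different-lengths : ∀ {i j} → i < j → j < n → length (drop i T$) ≢ length (drop j T$)
    different-lengths {i} {j} i<j j<n same = <⇒≢ i<j (∸-cancelˡ-≡ (≤-trans (<⇒≤ i<j) j≤|T$|) j≤|T$|
      (trans (sym (length-drop i T$)) (trans same (length-drop j T$))))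
      where j≤|T$| = ≤-trans (<⇒≤ j<n) n≤|T$|

  suffixes-budget : All (Budget k) suffixes
  suffixes-budget = All.map⁺ (All.universal (λ _ → ≤-refl) (upTo n))

  Σ-startsAt-suffixes≤1 : ∀ i → Σ⟨ startsAt i ⟩ suffixes ≤ 1
  Σ-startsAt-suffixes≤1 i = subst (_≤ 1) (cong sum (map-∘ (upTo n))) (Σ-indicator≤1 i (upTo⁺ n))

  module _ (4^k<n : 2 ^ (2 * k) < n) where

    2k<⌈log₂n⌉ : 2 * k < ⌈log₂ n ⌉
    2k<⌈log₂n⌉ = ≰⇒> λ ⌈log₂n⌉≤2k →
      <-irrefl refl (<-≤-trans 4^k<n (≤-trans (n≤2^⌈log₂n⌉ n) (^-monoʳ-≤ 2 ⌈log₂n⌉≤2k)))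

    binomSum≤C : binomSum ⌈log₂ n ⌉ (suc k) ≤ suc k * (⌈log₂ n ⌉ C k)
    binomSum≤C = binomSum≤[1+j]*hCj k (<⇒≤ 2k<⌈log₂n⌉)

    1≤C : 1 ≤ ⌈log₂ n ⌉ C k
    1≤C = 1≤m*n⇒1≤n (suc k) _ (≤-trans (1≤binomSum ⌈log₂ n ⌉ k) binomSum≤C)

    1≤n : 1 ≤ n
    1≤n = ≤-trans (m^n>0 2 (2 * k)) (<⇒≤ 4^k<n)

    pivotCount-T₀ : ∀ i → pivotCount i T₀ ≤ suc k * (⌈log₂ n ⌉ C k)
    pivotCount-T₀ i = begin
      pivotCount i T₀                                        ≤⟨ pivotCount≤Σ i T₀ ⟩
      Σ⟨ startsAt i ⟩ (contents T₀)
        ≤⟨ Σ-contents-build (startsAt i) startsAt-pivotAlter n k suffixes _ suffixes-admissible ⟩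
      Σ⟨ startsAt i ⟩ suffixes * binomSum ⌈log₂ n ⌉ (suc k)  ≤⟨ *-monoˡ-≤ _ (Σ-startsAt-suffixes≤1 i) ⟩
      1 * binomSum ⌈log₂ n ⌉ (suc k)                         ≡⟨ *-identityˡ _ ⟩
      binomSum ⌈log₂ n ⌉ (suc k)                             ≤⟨ binomSum≤C ⟩
      suc k * (⌈log₂ n ⌉ C k)                                ∎
      where
      open ≤-Reasoning
      startsAt-pivotAlter : ∀ p s → startsAt i (pivotAlter p s) ≡ startsAt i s
      startsAt-pivotAlter p s = cong (indicator i) (start-pivotAlter p s)

    treeWords-T₀ : treeWords T₀ ≤ n * (2 * k + 15) * (suc k * (⌈log₂ n ⌉ C k)) + 1
    treeWords-T₀ = begin
      treeWords T₀                                ≤⟨ treeWords≤Σ T₀ ⟩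
      Σ⟨ cost ⟩ (contents T₀) + 1
        ≤⟨ +-monoˡ-≤ 1 (Σ-mono (All.map (λ {s} → cost≤ s) (contents-budget n k suffixes suffixes-budget))) ⟩
      Σ⟨ (λ _ → 2 * k + 15) ⟩ (contents T₀) + 1
        ≤⟨ +-monoˡ-≤ 1 (Σ-contents-build (λ _ → 2 * k + 15) (λ _ _ → refl) n k suffixes _ suffixes-admissible) ⟩
      Σ⟨ (λ _ → 2 * k + 15) ⟩ suffixes * binomSum ⌈log₂ n ⌉ (suc k) + 1
        ≡⟨ cong (λ x → x * binomSum ⌈log₂ n ⌉ (suc k) + 1)
                (trans (Σ-const (2 * k + 15) suffixes) (cong (_* (2 * k + 15)) length-suffixes)) ⟩
      n * (2 * k + 15) * binomSum ⌈log₂ n ⌉ (suc k) + 1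
        ≤⟨ +-monoˡ-≤ 1 (*-monoʳ-≤ (n * (2 * k + 15)) binomSum≤C) ⟩
      n * (2 * k + 15) * (suc k * (⌈log₂ n ⌉ C k)) + 1 ∎
      where
      open ≤-Reasoning
      cost≤ : ∀ s → length (alts s) ≤ k → cost s ≤ 2 * k + 15
      cost≤ s alts≤k = ≤-trans (+-monoˡ-≤ 14 (s≤s (*-monoʳ-≤ 2 alts≤k))) (≤-reflexive (sym (+-suc (2 * k) 14)))

lemma6 : (D : ℕ) → Σ ℕ λ c →
    {A : Set} (_<A_ : Rel A 0ℓ) (sto : IsStrictTotalOrder _≡_ _<A_)
    (dollar : A) (T : List A) (k : ℕ) →
    ¬ (dollar ∈ T) → 1 ≤ k → 2 ^ (2 * k) < length T →
    let open CGL _<A_ sto dollar T k in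
    ((i : ℕ) → i < n → pivotCount i T₀ ≤ c * k * (⌈log₂ n ⌉ C k))
    × ((auxWords : ℕ) → auxWords ≤ D * n * (⌈log₂ n ⌉ C k) →
       totalWords auxWords T₀ ≤ c * n * (k * k) * (⌈log₂ n ⌉ C k))
lemma6 D = 35 + D , λ _<A_ sto dollar T k _ 1≤k 4^k<n →
  let open CGL _<A_ sto dollar T k
      open CGLSpace _<A_ sto dollar T k
      binom = ⌈log₂ n ⌉ C k
  in (λ i _ → ≤-trans (pivotCount-T₀ 4^k<n i) (pivot-arith D k binom 1≤k))
   , (λ aux aux≤ → ≤-trans (+-mono-≤ (treeWords-T₀ 4^k<n) aux≤)
                           (words-arith D k n binom 1≤k (1≤n 4^k<n) (1≤C 4^k<n)))
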